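{- Let $P$ be a uniform poset of length $\ell$ with associated uniform sequence $(P_0,\dots,P_\ell)$ and a uniform $P$-compatible weight function $\varpi_P$, inducing $P_i$-compatible weight functions $\varpi_{P_i}$. Then the matrices $[w_{i-j}(P_i,\varpi_{P_i})]_{0\le i,j\le\ell}$ and $[W_{i-j}(P_i,\varpi_{P_i})]_{0\le i,j\le\ell}$ are inverses of each other.
   Context: Posets are pure (all maximal chains of equal length) with a minimum $\hat0$ and rank function $\rho$ ($\rho(\hat0)=0$). For a commutative unitary ring $R$, a weight function $\varpi_P$ assigning to each closed interval $[x,y]$ of $P$ an element of $R$ is $P$-compatible if $\varpi_P(\alpha,\alpha)=1$ for all $\alpha$ and $\varpi_P(\theta,\beta)=\varpi_P(\theta,\alpha)\varpi_P(\alpha,\beta)$ whenever $\theta\le\alpha\le\beta$. Weighted Whitney numbers: $w_j(P,\varpi_P)=\sum_{\rho(\alpha)=j}\bar\mu_P(\hat0,\alpha)\varpi_P(\hat0,\alpha)$ ($\bar\mu_P$ Möbius function) and $W_j(P,\varpi_P)=\sum_{\rho(\alpha)=j}\varpi_P(\hat0,\alpha)$; these are $0$ for negative $j$. $P$ of length $\ell$ is uniform if there are posets $P_0,\dots,P_\ell$ such that for each $x\in P$ the upper ideal $I_x=\{y\in P:y\ge x\}$ is isomorphic to $P_{\ell-\rho(x)}$. A $P$-compatible weight function is uniform if for any $x,y$ with $\rho(x)=\rho(y)$ there is a poset isomorphism $f:I_x\to I_y$ with $\varpi_P(z,z')=\varpi_P(f(z),f(z'))$ for all $z\le z'$ in $I_x$;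 it then induces well-defined $P_i$-compatible weight functions $\varpi_{P_i}$ (via restriction to $I_x$ and the isomorphism $I_x\cong P_i$). -}

module Defs where

open import Level using (Level; _⊔_) renaming (suc to lsuc; zero to lzero)
open import Data.Nat using (ℕ; zero; suc; _∸_; _≤_; s≤s)
open import Data.Nat.Properties using (m∸n≤m)
import Data.Nat as ℕ
open import Data.Fin using (Fin; toℕ; fromℕ<)
import Data.Fin as F
open import Data.Bool using (Bool; true; false; if_then_else_; _∧_)
open import Data.List using (List; length)
open import Data.List.Membership.Propositional using (_∈_)
open import Data.List.Relation.Unary.Linked using (Linked)
open import Data.Product using (Σ; _×_; ∃; _,_)
open import Function.Bundles using (_⇔_)
open import Relation.Nullary using (¬_; Dec; yes; no)
open import Relation.Nullary.Decidable using (⌊_⌋)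
open import Relation.Binary.PropositionalEquality using (_≡_)
open import Relation.Binary.Structures using (IsDecPartialOrder)
open import Algebra.Bundles using (CommutativeRing)

record FinPoset : Set₁ where
  field
    size  : ℕ
    _≼_   : Fin size → Fin size → Set
    isDecPartialOrder : IsDecPartialOrder _≡_ _≼_

  open IsDecPartialOrder isDecPartialOrder public
    using () renaming (_≤?_ to _≼?_)

  _≺_ : Fin size → Fin size → Set
  x ≺ y = x ≼ y × ¬ (x ≡ y)

  Covers : Fin size → Fin size → Set
  Covers x y = x ≺ y × (∀ z → x ≺ z → z ≺ y → Data.Empty.⊥)
    where import Data.Empty

  -- chains = strictly increasing lists; length of a chain = #elements - 1
  IsChain : List (Fin size) → Set
  IsChain = Linked _≺_

  -- maximal chain: no chain properly contains it
  -- (chains have distinct elements, so c ⊆ c' with |c'| ≤ |c| means equality)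
  MaximalChain : List (Fin size) → Set
  MaximalChain c = IsChain c ×
    (∀ c' → IsChain c' → (∀ {x} → x ∈ c → x ∈ c') → length c' ≤ length c)

  PureOfLength : ℕ → Set
  PureOfLength ℓ = ∀ c → MaximalChain c → length c ≡ suc ℓ

record GradedPoset : Set₁ where
  field
    poset      : FinPoset
  open FinPoset poset public
  field
    bot        : Fin size
    bot-min    : ∀ x → bot ≼ x
    rank       : Fin size → ℕ
    rank-bot   : rank bot ≡ 0
    rank-cover : ∀ x y → Covers x y → rank y ≡ suc (rank x)



Pt : GradedPoset → Set
Pt P = Fin (GradedPoset.size P)

-- Isomorphism between the upper ideal I_x of P and the upper ideal I_y of Q
-- (given by a function on all points, only its restriction to I_x matters)

record UpIso (P : GradedPoset) (x : Pt P) (Q : GradedPoset) (y : Pt Q) : Set where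
  private
    module P = GradedPoset P
    module Q = GradedPoset Q
  field
    to    : Pt P → Pt Q
    into  : ∀ z → x P.≼ z → y Q.≼ to z
    order : ∀ z z' → x P.≼ z → x P.≼ z' → (z P.≼ z' ⇔ to z Q.≼ to z')
    onto  : ∀ w → y Q.≼ w → Σ (Pt P) λ z → x P.≼ z × to z ≡ w

open UpIso public using (to)

-- I_x ≅ Q  (Q's upper ideal of its minimum is Q itself)
IdealIso : (P : GradedPoset) → Pt P → GradedPoset → Set
IdealIso P x Q = UpIso P x Q (GradedPoset.bot Q)

idx : (ℓ k : ℕ) → Fin (suc ℓ)
idx ℓ k = fromℕ< (s≤s (m∸n≤m ℓ k))

IsUniformSeq : (P : GradedPoset) (ℓ : ℕ) → (Fin (suc ℓ) → GradedPoset) → Set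
IsUniformSeq P ℓ Ps = ∀ x → IdealIso P x (Ps (idx ℓ (GradedPoset.rank P x)))

module _ {c r : Level} (R : CommutativeRing c r) where
  open CommutativeRing R

  -- a weight function (its values are only relevant on intervals z ≤ z')
  Weight : GradedPoset → Set c
  Weight P = Pt P → Pt P → Carrier

  Compatible : (P : GradedPoset) → Weight P → Set r
  Compatible P ϖ =
    (∀ α → ϖ α α ≈ 1#) ×
    (∀ θ α β → θ ≼ α → α ≼ β → ϖ θ β ≈ ϖ θ α * ϖ α β)
    where open GradedPoset P

  UniformWeight : (P : GradedPoset) → Weight P → Set r
  UniformWeight P ϖ = ∀ x y → GradedPoset.rank P x ≡ GradedPoset.rank P y →
    Σ (UpIso P x P y) λ f →
      ∀ z z' → x ≼ z → z ≼ z' → ϖ z z' ≈ ϖ (to f z) (to f z')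
    where open GradedPoset P

  -- v is the weight on Q = P_i induced from ϖ via restriction to some I_x
  -- (ρ x = ℓ - i) and an isomorphism I_x ≅ Q
  InducedWeight : (P : GradedPoset) → Weight P → (ℓ : ℕ) → Fin (suc ℓ) →
                  (Q : GradedPoset) → Weight Q → Set r
  InducedWeight P ϖ ℓ i Q v =
    Σ (Pt P) λ x → (GradedPoset.rank P x ℕ.+ toℕ i ≡ ℓ) ×
      Σ (IdealIso P x Q) λ φ →
        ∀ z z' → x ≼ z → z ≼ z' → v (to φ z) (to φ z') ≈ ϖ z z'
    where open GradedPoset P

  sumFin : (n : ℕ) → (Fin n → Carrier) → Carrier
  sumFin zero    f = 0#
  sumFin (suc n) f = f F.zero + sumFin n (λ k → f (F.suc k))

  when : Bool → Carrier → Carrier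
  when b a = if b then a else 0#

  module _ (P : GradedPoset) where
    open GradedPoset P

    -- Möbius function by the recursion μ(x,x)=1, μ(x,y) = - Σ_{x≤z<y} μ(x,z);
    -- the fuel argument is set to |P|, which exceeds every chain length.
    mobiusFuel : ℕ → Pt P → Pt P → Carrier
    mobiusFuel zero    x y = 0#
    mobiusFuel (suc k) x y with x F.≟ y
    ... | yes _ = 1#
    ... | no  _ with x ≼? y
    ...   | no  _ = 0#
    ...   | yes _ = - sumFin size (λ z →
                        when (⌊ x ≼? z ⌋ ∧ ⌊ z ≼? y ⌋ ∧ Data.Bool.not ⌊ z F.≟ y ⌋)
                             (mobiusFuel k x z))
      where import Data.Bool

    mobius : Pt P → Pt P → Carrier
    mobius = mobiusFuel size

    whitney-w : Weight P → ℕ → Carrier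
    whitney-w ϖ j = sumFin size (λ α →
      when ⌊ rank α ℕ.≟ j ⌋ (mobius bot α * ϖ bot α))

    whitney-W : Weight P → ℕ → Carrier
    whitney-W ϖ j = sumFin size (λ α → when ⌊ rank α ℕ.≟ j ⌋ (ϖ bot α))

  Matrix : ℕ → Set c
  Matrix ℓ = Fin (suc ℓ) → Fin (suc ℓ) → Carrier

  _⊗_ : ∀ {ℓ} → Matrix ℓ → Matrix ℓ → Matrix ℓ
  _⊗_ {ℓ} A B i j = sumFin (suc ℓ) (λ k → A i k * B k j)

  identity : ∀ {ℓ} → Matrix ℓ
  identity i j = when ⌊ i F.≟ j ⌋ 1#

  _≈M_ : ∀ {ℓ} → Matrix ℓ → Matrix ℓ → Set r
  A ≈M B = ∀ i j → A i j ≈ B i j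

  InverseMatrices : ∀ {ℓ} → Matrix ℓ → Matrix ℓ → Set r
  InverseMatrices A B = (A ⊗ B) ≈M identity × (B ⊗ A) ≈M identity

  -- [w_{i-j}(P_i, ϖ_{P_i})]_{0≤i,j≤ℓ}, entries with i - j < 0 are 0
  wMatrix : (ℓ : ℕ) (Ps : Fin (suc ℓ) → GradedPoset) →
            ((i : Fin (suc ℓ)) → Weight (Ps i)) → Matrix ℓ
  wMatrix ℓ Ps ϖs i j =
    when ⌊ toℕ j ℕ.≤? toℕ i ⌋ (whitney-w (Ps i) (ϖs i) (toℕ i ∸ toℕ j))

  WMatrix : (ℓ : ℕ) (Ps : Fin (suc ℓ) → GradedPoset) →
            ((i : Fin (suc ℓ)) → Weight (Ps i)) → Matrix ℓ
  WMatrix ℓ Ps ϖs i j =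
    when ⌊ toℕ j ℕ.≤? toℕ i ⌋ (whitney-W (Ps i) (ϖs i) (toℕ i ∸ toℕ j))

-- Write L(x, e) = Σ_{y ≥ x, ρ(y) = e} ϖ(x, y) for the level sums of a poset. The proof:
--  * W_d(P_k) = L(0̂, d), level sums are preserved by weight-preserving isomorphisms
--    of upper ideals (which shift ranks uniformly), so by uniformity W_d(P_k) equals
--    L(x, ρ(x) + d) in P_i for every x with ρ(x) + k = i;
--  * regrouping (w W)_{ij} by x ∈ P_i therefore gives Σ_x μ(0̂,x) ϖ(0̂,x) L(x, i - j), and
--    multiplicativity of ϖ together with Σ_{x ≤ y} μ(0̂,x) = δ(y,0̂) reduces it to [i = j];
--  * w is lower unitriangular (w_0 = 1), hence left cancellable, so W w = I as well.
module Submission where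

open import Defs
open import Level using (Level)
open import Data.Nat using (ℕ; zero; suc)
import Data.Nat as ℕ
import Data.Nat.Properties as ℕP
open import Data.Fin as F using (Fin; toℕ)
import Data.Fin.Properties as FP
open import Data.Bool using (Bool; true; false)
open import Data.Product using (Σ; _×_; _,_; proj₁; proj₂; ∃)
open import Relation.Nullary using (¬_; Dec; yes; no)
open import Relation.Nullary.Decidable using (⌊_⌋; _×-dec_)
open import Relation.Binary.PropositionalEquality as ≡ using (_≡_; _≢_)
open import Data.Empty using (⊥-elim)
open import Algebra.Bundles using (CommutativeRing)

module FiniteSums {c r : Level} (R : CommutativeRing c r) where
  open CommutativeRing R
  open import Algebra.Properties.Semiring.Sum semiring
    using (sum; sum-cong-≋; sum-replicate-zero; ∑-distrib-+; ∑-comm;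
           *-distribˡ-sum; *-distribʳ-sum; sum-remove)
  open import Algebra.Properties.AbelianGroup +-abelianGroup using (∙-cancelʳ)
  open import Relation.Binary.Reasoning.Setoid setoid

  sumFin≡sum : ∀ n (f : Fin n → Carrier) → sumFin R n f ≡ sum f
  sumFin≡sum zero    f = ≡.refl
  sumFin≡sum (suc n) f = ≡.cong (f F.zero +_) (sumFin≡sum n (λ k → f (F.suc k)))

  ∑ : (n : ℕ) → (Fin n → Carrier) → Carrier
  ∑ = sumFin R

  ∑-cong : ∀ n {f g : Fin n → Carrier} → (∀ k → f k ≈ g k) → ∑ n f ≈ ∑ n g
  ∑-cong n {f} {g} f≈g = begin
    ∑ n f ≡⟨ sumFin≡sum n f ⟩
    sum f ≈⟨ sum-cong-≋ f≈g ⟩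
    sum g ≡⟨ sumFin≡sum n g ⟨
    ∑ n g ∎

  ∑-zero : ∀ n {f : Fin n → Carrier} → (∀ k → f k ≈ 0#) → ∑ n f ≈ 0#
  ∑-zero n {f} f≈0 = begin
    ∑ n f ≡⟨ sumFin≡sum n f ⟩
    sum f ≈⟨ sum-cong-≋ f≈0 ⟩
    sum {n} (λ _ → 0#) ≈⟨ sum-replicate-zero n ⟩
    0# ∎

  ∑-+ : ∀ n (f g : Fin n → Carrier) → ∑ n (λ k → f k + g k) ≈ ∑ n f + ∑ n g
  ∑-+ n f g = begin
    ∑ n (λ k → f k + g k) ≡⟨ sumFin≡sum n _ ⟩
    sum (λ k → f k + g k) ≈⟨ ∑-distrib-+ f g ⟩
    sum f + sum g         ≡⟨ ≡.cong₂ _+_ (sumFin≡sum n f) (sumFin≡sum n g) ⟨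
    ∑ n f + ∑ n g ∎

  ∑-*ˡ : ∀ n a (f : Fin n → Carrier) → a * ∑ n f ≈ ∑ n (λ k → a * f k)
  ∑-*ˡ n a f = begin
    a * ∑ n f            ≡⟨ ≡.cong (a *_) (sumFin≡sum n f) ⟩
    a * sum f            ≈⟨ *-distribˡ-sum a f ⟩
    sum (λ k → a * f k)  ≡⟨ sumFin≡sum n _ ⟨
    ∑ n (λ k → a * f k) ∎

  ∑-*ʳ : ∀ n a (f : Fin n → Carrier) → ∑ n f * a ≈ ∑ n (λ k → f k * a)
  ∑-*ʳ n a f = begin
    ∑ n f * a            ≡⟨ ≡.cong (_* a) (sumFin≡sum n f) ⟩
    sum f * a            ≈⟨ *-distribʳ-sum a f ⟩
    sum (λ k → f k * a)  ≡⟨ sumFin≡sum n _ ⟨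
    ∑ n (λ k → f k * a) ∎

  ∑-swap : ∀ n m (f : Fin n → Fin m → Carrier) →
           ∑ n (λ a → ∑ m (f a)) ≈ ∑ m (λ b → ∑ n (λ a → f a b))
  ∑-swap n m f = begin
    ∑ n (λ a → ∑ m (f a))             ≈⟨ ∑-cong n (λ a → reflexive (sumFin≡sum m (f a))) ⟩
    ∑ n (λ a → sum (f a))             ≡⟨ sumFin≡sum n _ ⟩
    sum (λ a → sum (f a))             ≈⟨ ∑-comm f ⟩
    sum (λ b → sum (λ a → f a b))     ≡⟨ sumFin≡sum m _ ⟨
    ∑ m (λ b → sum (λ a → f a b))     ≈⟨ ∑-cong m (λ b → reflexive (sumFin≡sum n _)) ⟨
    ∑ m (λ b → ∑ n (λ a → f a b)) ∎

  ∑-split : ∀ n (f : Fin (suc n) → Carrier) (i : Fin (suc n)) →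
            ∑ (suc n) f ≈ f i + ∑ n (λ k → f (F.punchIn i k))
  ∑-split n f i = begin
    ∑ (suc n) f                          ≡⟨ sumFin≡sum (suc n) f ⟩
    sum f                                ≈⟨ sum-remove f ⟩
    f i + sum (λ k → f (F.punchIn i k))  ≡⟨ ≡.cong (f i +_) (sumFin≡sum n _) ⟨
    f i + ∑ n (λ k → f (F.punchIn i k)) ∎

  ∑-single : ∀ n (f : Fin n → Carrier) (i : Fin n) →
             (∀ k → k ≢ i → f k ≈ 0#) → ∑ n f ≈ f i
  ∑-single (suc n) f i off = begin
    ∑ (suc n) f                          ≈⟨ ∑-split n f i ⟩
    f i + ∑ n (λ k → f (F.punchIn i k))  ≈⟨ +-congˡ (∑-zero n (λ k → off _ (FP.punchInᵢ≢i i k))) ⟩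
    f i + 0#                             ≈⟨ +-identityʳ (f i) ⟩
    f i ∎

  ∑-agree-at : ∀ n (f g : Fin n → Carrier) (i : Fin n) →
               (∀ k → k ≢ i → f k ≈ g k) → ∑ n f ≈ ∑ n g → f i ≈ g i
  ∑-agree-at (suc n) f g i off ∑f≈∑g = ∙-cancelʳ (∑ n (λ k → g (F.punchIn i k))) (f i) (g i) (begin
    f i + ∑ n (λ k → g (F.punchIn i k))  ≈⟨ +-congˡ (∑-cong n (λ k → off _ (FP.punchInᵢ≢i i k))) ⟨
    f i + ∑ n (λ k → f (F.punchIn i k))  ≈⟨ ∑-split n f i ⟨
    ∑ (suc n) f                          ≈⟨ ∑f≈∑g ⟩
    ∑ (suc n) g                          ≈⟨ ∑-split n g i ⟩
    g i + ∑ n (λ k → g (F.punchIn i k))  ∎)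

  [_]·_ : Bool → Carrier → Carrier
  [_]·_ = when R

  when-yes : ∀ {p} {P : Set p} (d : Dec P) → P → ∀ x → [ ⌊ d ⌋ ]· x ≈ x
  when-yes (yes _) _ x = refl
  when-yes (no ¬p) p x = ⊥-elim (¬p p)

  when-no : ∀ {p} {P : Set p} (d : Dec P) → ¬ P → ∀ x → [ ⌊ d ⌋ ]· x ≈ 0#
  when-no (yes p) ¬p x = ⊥-elim (¬p p)
  when-no (no _)  _  x = refl

  when-cong : ∀ {p} {P : Set p} (d : Dec P) {x y} → (P → x ≈ y) → [ ⌊ d ⌋ ]· x ≈ [ ⌊ d ⌋ ]· y
  when-cong (yes p) x≈y = x≈y p
  when-cong (no _)  _   = refl

  when-⇔ : ∀ {p q} {P : Set p} {Q : Set q} (d : Dec P) (e : Dec Q) →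
           (P → Q) → (Q → P) → ∀ x → [ ⌊ d ⌋ ]· x ≈ [ ⌊ e ⌋ ]· x
  when-⇔ (yes p) e to from x = sym (when-yes e (to p) x)
  when-⇔ (no ¬p) e to from x = sym (when-no e (λ q → ¬p (from q)) x)

  when-zero : ∀ b → [ b ]· 0# ≈ 0#
  when-zero true  = refl
  when-zero false = refl

  when-*ʳ : ∀ b x y → [ b ]· x * y ≈ [ b ]· (x * y)
  when-*ʳ true  x y = refl
  when-*ʳ false x y = zeroˡ y

  when-∑ : ∀ b n (f : Fin n → Carrier) → [ b ]· ∑ n f ≈ ∑ n (λ k → [ b ]· f k)
  when-∑ true  n f = refl
  when-∑ false n f = sym (∑-zero n (λ _ → refl))

  when-when-⇔ : ∀ {p q s} {P : Set p} {Q : Set q} {S : Set s} (d : Dec P) (e : Dec Q) (f : Dec S) →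
                (P → Q → S) → (S → P × Q) → ∀ x → [ ⌊ d ⌋ ]· ([ ⌊ e ⌋ ]· x) ≈ [ ⌊ f ⌋ ]· x
  when-when-⇔ (yes p) e f to from x = when-⇔ e f (to p) (λ s → proj₂ (from s)) x
  when-when-⇔ (no ¬p) e f to from x = sym (when-no f (λ s → ¬p (proj₁ (from s))) x)

  ∑-at-difference : ∀ {n} (i : Fin n) r (h : ℕ → Carrier) →
    ∑ n (λ k → [ ⌊ r ℕ.+ toℕ k ℕ.≟ toℕ i ⌋ ]· h (toℕ k)) ≈ [ ⌊ r ℕ.≤? toℕ i ⌋ ]· h (toℕ i ℕ.∸ r)
  ∑-at-difference {n} i r h with r ℕ.≤? toℕ i
  ... | no r≰I = ∑-zero n (λ k → when-no (r ℕ.+ toℕ k ℕ.≟ toℕ i)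
                   (λ e → r≰I (≡.subst (r ℕ.≤_) e (ℕP.m≤m+n r (toℕ k)))) _)
  ... | yes r≤I = trans (∑-single n _ k₀ off)
                        (trans (when-yes (r ℕ.+ toℕ k₀ ℕ.≟ toℕ i) solves _) (reflexive (≡.cong h toℕ-k₀)))
    where
    k₀ : Fin n
    k₀ = F.fromℕ< (ℕP.≤-<-trans (ℕP.m∸n≤m (toℕ i) r) (FP.toℕ<n i))
    toℕ-k₀ : toℕ k₀ ≡ toℕ i ℕ.∸ r
    toℕ-k₀ = FP.toℕ-fromℕ< _
    solves : r ℕ.+ toℕ k₀ ≡ toℕ i
    solves = ≡.trans (≡.cong (r ℕ.+_) toℕ-k₀) (ℕP.m+[n∸m]≡n r≤I)
    off : ∀ k → k ≢ k₀ → [ ⌊ r ℕ.+ toℕ k ℕ.≟ toℕ i ⌋ ]· h (toℕ k) ≈ 0#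
    off k k≢k₀ = when-no (r ℕ.+ toℕ k ℕ.≟ toℕ i) (λ e → k≢k₀ (FP.toℕ-injective
                   (≡.trans (≡.trans (≡.sym (ℕP.m+n∸m≡n r (toℕ k))) (≡.cong (ℕ._∸ r) e)) (≡.sym toℕ-k₀)))) _

  module _ {n m : ℕ} {s t : Level} {S : Fin n → Set s} {T : Fin m → Set t}
           (S? : ∀ a → Dec (S a)) (T? : ∀ b → Dec (T b)) (g : Fin n → Fin m)
           (maps : ∀ {a} → S a → T (g a))
           (injective : ∀ {a a'} → S a → S a' → g a ≡ g a' → a ≡ a')
           (onto : ∀ {b} → T b → ∃ λ a → S a × g a ≡ b) where

    ∑-reindex : (h : Fin m → Carrier) → ∑ n (λ a → [ ⌊ S? a ⌋ ]· h (g a)) ≈ ∑ m (λ b → [ ⌊ T? b ⌋ ]· h b)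
    ∑-reindex h = begin
      ∑ n (λ a → [ ⌊ S? a ⌋ ]· h (g a))                        ≈⟨ ∑-cong n expand ⟩
      ∑ n (λ a → ∑ m (λ b → [ ⌊ S? a ⌋ ]· hit a b))           ≈⟨ ∑-swap n m _ ⟩
      ∑ m (λ b → ∑ n (λ a → [ ⌊ S? a ⌋ ]· hit a b))           ≈⟨ ∑-cong m collect ⟩
      ∑ m (λ b → [ ⌊ T? b ⌋ ]· h b) ∎
      where
      hit : Fin n → Fin m → Carrier
      hit a b = [ ⌊ g a F.≟ b ⌋ ]· h b

      expand : ∀ a → [ ⌊ S? a ⌋ ]· h (g a) ≈ ∑ m (λ b → [ ⌊ S? a ⌋ ]· hit a b)
      expand a = begin
        [ ⌊ S? a ⌋ ]· h (g a)          ≈⟨ when-cong (S? a) (λ _ → sym hit-once) ⟩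
        [ ⌊ S? a ⌋ ]· ∑ m (hit a)      ≈⟨ when-∑ ⌊ S? a ⌋ m (hit a) ⟩
        ∑ m (λ b → [ ⌊ S? a ⌋ ]· hit a b) ∎
        where
        miss : ∀ b → b ≢ g a → hit a b ≈ 0#
        miss b b≢ga = when-no (g a F.≟ b) (λ e → b≢ga (≡.sym e)) (h b)
        hit-once : ∑ m (hit a) ≈ h (g a)
        hit-once = trans (∑-single m (hit a) (g a) miss) (when-yes (g a F.≟ g a) ≡.refl (h (g a)))

      collect : ∀ b → ∑ n (λ a → [ ⌊ S? a ⌋ ]· hit a b) ≈ [ ⌊ T? b ⌋ ]· h b
      collect b with T? b
      ... | no ¬Tb = ∑-zero n none
        where
        none : ∀ a → [ ⌊ S? a ⌋ ]· hit a b ≈ 0#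
        none a = trans (when-cong (S? a) (λ Sa →
                   when-no (g a F.≟ b) (λ e → ¬Tb (≡.subst T e (maps Sa))) (h b)))
                   (when-zero ⌊ S? a ⌋)
      ... | yes Tb with onto Tb
      ...   | a₀ , Sa₀ , ga₀≡b = trans (∑-single n _ a₀ others)
                                  (trans (when-yes (S? a₀) Sa₀ _) (when-yes (g a₀ F.≟ b) ga₀≡b (h b)))
        where
        others : ∀ a → a ≢ a₀ → [ ⌊ S? a ⌋ ]· hit a b ≈ 0#
        others a a≢a₀ = trans (when-cong (S? a) (λ Sa →
                          when-no (g a F.≟ b) (λ e → a≢a₀ (injective Sa Sa₀ (≡.trans e (≡.sym ga₀≡b)))) (h b)))
                          (when-zero ⌊ S? a ⌋)

module GradedFacts (P : GradedPoset) where
  open GradedPoset P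
  open import Data.Nat using (_<_; _≤_)
  open import Function using (flip)
  open import Induction.WellFounded using (Acc; acc; WellFounded)
  import Data.Fin.Induction as FinInd
  open import Relation.Nullary using (¬?)
  open import Relation.Binary.Structures using (IsDecPartialOrder)
  open IsDecPartialOrder isDecPartialOrder public
    using (isPartialOrder) renaming (refl to ≼-refl; trans to ≼-trans; antisym to ≼-antisym; reflexive to ≼-reflexive)

  ≺-wellFounded : WellFounded _≺_
  ≺-wellFounded = FinInd.po-wellFounded isPartialOrder

  ≻-wellFounded : WellFounded (flip _≺_)
  ≻-wellFounded = FinInd.po-noetherian isPartialOrder

  _≺?_ : ∀ x y → Dec (x ≺ y)
  x ≺? y = (x ≼? y) ×-dec ¬? (x F.≟ y)

  covered-between : ∀ x y → x ≺ y → Σ (Pt P) λ w → x ≼ w × Covers w y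
  covered-between x = go x (≻-wellFounded x)
    where
    go : ∀ x → Acc (flip _≺_) x → ∀ y → x ≺ y → Σ (Pt P) λ w → x ≼ w × Covers w y
    go x (acc above) y x≺y with FP.any? (λ z → (x ≺? z) ×-dec (z ≺? y))
    ... | yes (z , x≺z , z≺y) with go z (above x≺z) y z≺y
    ...   | w , z≼w , w⋖y = w , ≼-trans (proj₁ x≺z) z≼w , w⋖y
    go x (acc above) y x≺y | no nothing-between =
      x , ≼-refl , (x≺y , λ z x≺z z≺y → nothing-between (z , x≺z , z≺y))

  rank-< : ∀ {x y} → x ≺ y → rank x < rank y
  rank-< {x} {y} = go y (≺-wellFounded y)
    where
    go : ∀ y → Acc _≺_ y → x ≺ y → rank x < rank y
    go y (acc below) x≺y with covered-between x y x≺y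
    ... | w , x≼w , w⋖y rewrite rank-cover w y w⋖y with x F.≟ w
    ...   | yes ≡.refl = ℕP.≤-refl
    ...   | no x≢w = ℕP.m≤n⇒m≤1+n (go w (below (proj₁ w⋖y)) (x≼w , x≢w))

  rank-≤ : ∀ {x y} → x ≼ y → rank x ≤ rank y
  rank-≤ {x} {y} x≼y with x F.≟ y
  ... | yes ≡.refl = ℕP.≤-refl
  ... | no x≢y = ℕP.<⇒≤ (rank-< (x≼y , x≢y))

  rank≡0⇒bot : ∀ y → rank y ≡ 0 → y ≡ bot
  rank≡0⇒bot y rank≡0 with bot F.≟ y
  ... | yes bot≡y = ≡.sym bot≡y
  ... | no bot≢y = ⊥-elim (ℕP.<-irrefl (≡.trans rank-bot (≡.sym rank≡0)) (rank-< (bot-min y , bot≢y)))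

  rank-attained : ∀ y r → r ≤ rank y → Σ (Pt P) λ z → z ≼ y × rank z ≡ r
  rank-attained y = go y (≺-wellFounded y)
    where
    go : ∀ y → Acc _≺_ y → ∀ r → r ≤ rank y → Σ (Pt P) λ z → z ≼ y × rank z ≡ r
    go y (acc below) r r≤ with r ℕ.≟ rank y | bot F.≟ y
    ... | yes r≡ | _ = y , ≼-refl , ≡.sym r≡
    ... | no r≢ | yes ≡.refl = ⊥-elim (r≢ (≡.trans (ℕP.n≤0⇒n≡0 (≡.subst (r ≤_) rank-bot r≤)) (≡.sym rank-bot)))
    ... | no r≢ | no bot≢y with covered-between bot y (bot-min y , bot≢y)
    ...   | w , _ , w⋖y with go w (below (proj₁ w⋖y)) r
                             (ℕP.≤-pred (≡.subst (r <_) (rank-cover w y w⋖y) (ℕP.≤∧≢⇒< r≤ r≢)))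
    ...     | z , z≼w , rank-z = z , ≼-trans z≼w (proj₁ (proj₁ w⋖y)) , rank-z

  -- Ranks are smaller than the number of elements (pigeonhole on a chain below y).
  rank<size : ∀ y → rank y < size
  rank<size y = FP.injective⇒≤ {f = at-rank} injective
    where
    at-rank : Fin (suc (rank y)) → Pt P
    at-rank i = proj₁ (rank-attained y (toℕ i) (ℕP.≤-pred (FP.toℕ<n i)))
    rank-at : ∀ i → rank (at-rank i) ≡ toℕ i
    rank-at i = proj₂ (proj₂ (rank-attained y (toℕ i) (ℕP.≤-pred (FP.toℕ<n i))))
    injective : ∀ {i j} → at-rank i ≡ at-rank j → i ≡ j
    injective {i} {j} e = FP.toℕ-injective (≡.trans (≡.sym (rank-at i)) (≡.trans (≡.cong rank e) (rank-at j)))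

-- An isomorphism φ : I_a ≅ I_b of upper ideals is injective, sends a to b,
-- preserves covers, and hence shifts ranks by the constant ρ(b) - ρ(a).
module UpIsoFacts {P Q : GradedPoset} {a : Pt P} {b : Pt Q} (φ : UpIso P a Q b) where
  private
    module P = GradedPoset P
    module Q = GradedPoset Q
    module GP = GradedFacts P
    module GQ = GradedFacts Q
  open UpIso φ
  open import Function.Bundles using (Equivalence)
  open Equivalence using (from)
  open import Induction.WellFounded using (Acc; acc)
  open import Algebra.Properties.CommutativeSemigroup ℕP.+-commutativeSemigroup
    using () renaming (xy∙z≈xz∙y to +-right-comm)

  mono : ∀ {z z'} → a P.≼ z → z P.≼ z' → to φ z Q.≼ to φ z'
  mono {z} {z'} a≼z z≼z' = Equivalence.to (order z z' a≼z (GP.≼-trans a≼z z≼z')) z≼z'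

  reflect : ∀ {z z'} → a P.≼ z → a P.≼ z' → to φ z Q.≼ to φ z' → z P.≼ z'
  reflect {z} {z'} a≼z a≼z' = from (order z z' a≼z a≼z')

  injective : ∀ {z z'} → a P.≼ z → a P.≼ z' → to φ z ≡ to φ z' → z ≡ z'
  injective a≼z a≼z' e =
    GP.≼-antisym (reflect a≼z a≼z' (GQ.≼-reflexive e)) (reflect a≼z' a≼z (GQ.≼-reflexive (≡.sym e)))

  to-base : to φ a ≡ b
  to-base with onto b GQ.≼-refl
  ... | z , a≼z , φz≡b =
    GQ.≼-antisym (≡.subst (to φ a Q.≼_) φz≡b (mono GP.≼-refl a≼z)) (into a GP.≼-refl)

  covers : ∀ {w z} → a P.≼ w → P.Covers w z → Q.Covers (to φ w) (to φ z)
  covers {w} {z} a≼w ((w≼z , w≢z) , nothing-between) =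
    (mono a≼w w≼z , λ e → w≢z (injective a≼w a≼z e)) , nothing-between'
    where
    a≼z : a P.≼ z
    a≼z = GP.≼-trans a≼w w≼z
    nothing-between' : ∀ u → to φ w Q.≺ u → u Q.≺ to φ z → _
    nothing-between' u (φw≼u , φw≢u) (u≼φz , u≢φz) with onto u (GQ.≼-trans (into w a≼w) φw≼u)
    ... | t , a≼t , ≡.refl =
      nothing-between t (reflect a≼w a≼t φw≼u , λ e → φw≢u (≡.cong (to φ) e))
                        (reflect a≼t a≼z u≼φz , λ e → u≢φz (≡.cong (to φ) e))

  rank-shift : ∀ z → a P.≼ z → Q.rank (to φ z) ℕ.+ P.rank a ≡ P.rank z ℕ.+ Q.rank b
  rank-shift z = go z (GP.≺-wellFounded z)
    where
    open ≡.≡-Reasoning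
    go : ∀ z → Acc P._≺_ z → a P.≼ z → Q.rank (to φ z) ℕ.+ P.rank a ≡ P.rank z ℕ.+ Q.rank b
    go z (acc below) a≼z with a F.≟ z
    ... | yes ≡.refl = begin
      Q.rank (to φ a) ℕ.+ P.rank a ≡⟨ ≡.cong (λ q → Q.rank q ℕ.+ P.rank a) to-base ⟩
      Q.rank b ℕ.+ P.rank a        ≡⟨ ℕP.+-comm (Q.rank b) (P.rank a) ⟩
      P.rank a ℕ.+ Q.rank b        ∎
    ... | no a≢z with GP.covered-between a z (a≼z , a≢z)
    ...   | w , a≼w , w⋖z = begin
      Q.rank (to φ z) ℕ.+ P.rank a       ≡⟨ ≡.cong (ℕ._+ P.rank a) (Q.rank-cover _ _ (covers a≼w w⋖z)) ⟩
      suc (Q.rank (to φ w) ℕ.+ P.rank a) ≡⟨ ≡.cong suc (go w (below (proj₁ w⋖z)) a≼w) ⟩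
      suc (P.rank w ℕ.+ Q.rank b)        ≡⟨ ≡.cong (ℕ._+ Q.rank b) (P.rank-cover w z w⋖z) ⟨
      P.rank z ℕ.+ Q.rank b              ∎

  rank-difference : ∀ {z s} d → a P.≼ z → a P.≼ s →
                    P.rank s ≡ P.rank z ℕ.+ d → Q.rank (to φ s) ≡ Q.rank (to φ z) ℕ.+ d
  rank-difference {z} {s} d a≼z a≼s s-level = ℕP.+-cancelʳ-≡ (P.rank a) _ _ (begin
    Q.rank (to φ s) ℕ.+ P.rank a              ≡⟨ rank-shift s a≼s ⟩
    P.rank s ℕ.+ Q.rank b                     ≡⟨ ≡.cong (ℕ._+ Q.rank b) s-level ⟩
    (P.rank z ℕ.+ d) ℕ.+ Q.rank b             ≡⟨ +-right-comm (P.rank z) d (Q.rank b) ⟩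
    (P.rank z ℕ.+ Q.rank b) ℕ.+ d             ≡⟨ ≡.cong (ℕ._+ d) (rank-shift z a≼z) ⟨
    (Q.rank (to φ z) ℕ.+ P.rank a) ℕ.+ d      ≡⟨ +-right-comm (Q.rank (to φ z)) (P.rank a) d ⟩
    (Q.rank (to φ z) ℕ.+ d) ℕ.+ P.rank a      ∎)
    where open ≡.≡-Reasoning

  rank-difference⁻¹ : ∀ {z s} d → a P.≼ z → a P.≼ s →
                      Q.rank (to φ s) ≡ Q.rank (to φ z) ℕ.+ d → P.rank s ≡ P.rank z ℕ.+ d
  rank-difference⁻¹ {z} {s} d a≼z a≼s s-level = ℕP.+-cancelʳ-≡ (Q.rank b) _ _ (begin
    P.rank s ℕ.+ Q.rank b                     ≡⟨ rank-shift s a≼s ⟨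
    Q.rank (to φ s) ℕ.+ P.rank a              ≡⟨ ≡.cong (ℕ._+ P.rank a) s-level ⟩
    (Q.rank (to φ z) ℕ.+ d) ℕ.+ P.rank a      ≡⟨ +-right-comm (Q.rank (to φ z)) d (P.rank a) ⟩
    (Q.rank (to φ z) ℕ.+ P.rank a) ℕ.+ d      ≡⟨ ≡.cong (ℕ._+ d) (rank-shift z a≼z) ⟩
    (P.rank z ℕ.+ Q.rank b) ℕ.+ d             ≡⟨ +-right-comm (P.rank z) (Q.rank b) d ⟩
    (P.rank z ℕ.+ d) ℕ.+ Q.rank b             ∎)
    where open ≡.≡-Reasoning

module MobiusFacts {c r : Level} (R : CommutativeRing c r) (P : GradedPoset) where
  open CommutativeRing R
  open FiniteSums R
  open GradedPoset P
  open GradedFacts P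
  open import Data.Nat using (_<_)
  open import Data.Bool using (_∧_; not)
  open import Relation.Binary.Reasoning.Setoid setoid

  μ : ℕ → Pt P → Carrier
  μ s = mobiusFuel R P s bot

  below : Pt P → Pt P → Bool
  below z y = ⌊ bot ≼? z ⌋ ∧ ⌊ z ≼? y ⌋ ∧ not ⌊ z F.≟ y ⌋

  μ-bot : ∀ s → μ (suc s) bot ≈ 1#
  μ-bot s with bot F.≟ bot
  ... | yes _ = refl
  ... | no bot≢bot = ⊥-elim (bot≢bot ≡.refl)

  μ-unfold : ∀ s y → bot ≢ y → μ (suc s) y ≈ - ∑ size (λ z → [ below z y ]· μ s z)
  μ-unfold s y bot≢y with bot F.≟ y
  ... | yes bot≡y = ⊥-elim (bot≢y bot≡y)
  ... | no _ with bot ≼? y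
  ...   | no bot⋠y = ⊥-elim (bot⋠y (bot-min y))
  ...   | yes _ = refl

  μ-stable : ∀ s y → rank y < s → μ s y ≈ μ (suc s) y
  μ-stable (suc s) y ρy<s with bot F.≟ y
  ... | yes _ = refl
  ... | no _ with bot ≼? y
  ...   | no _ = refl
  ...   | yes _ = -‿cong (∑-cong size stable-below)
    where
    stable-below : ∀ z → [ below z y ]· μ s z ≈ [ below z y ]· μ (suc s) z
    stable-below z with bot ≼? z | z ≼? y | z F.≟ y
    ... | yes _ | yes z≼y | no z≢y = μ-stable s z (ℕP.<-≤-trans (rank-< (z≼y , z≢y)) (ℕP.≤-pred ρy<s))
    ... | yes _ | yes _   | yes _  = refl
    ... | yes _ | no _    | _      = refl
    ... | no _  | _       | _      = refl

  μ-sum-vanishes : ∀ s y → bot ≢ y → rank y < suc s →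
                   ∑ size (λ x → [ ⌊ x ≼? y ⌋ ]· μ (suc s) x) ≈ 0#
  μ-sum-vanishes s y bot≢y ρy<1+s = begin
    ∑ size (λ x → [ ⌊ x ≼? y ⌋ ]· μ (suc s) x)
      ≈⟨ ∑-cong size split ⟩
    ∑ size (λ x → [ ⌊ x F.≟ y ⌋ ]· μ (suc s) x + [ below x y ]· μ s x)
      ≈⟨ ∑-+ size _ _ ⟩
    ∑ size (λ x → [ ⌊ x F.≟ y ⌋ ]· μ (suc s) x) + ∑ size (λ x → [ below x y ]· μ s x)
      ≈⟨ +-congʳ (∑-single size _ y (λ x x≢y → when-no (x F.≟ y) x≢y _)) ⟩
    [ ⌊ y F.≟ y ⌋ ]· μ (suc s) y + ∑ size (λ x → [ below x y ]· μ s x)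
      ≈⟨ +-congʳ (trans (when-yes (y F.≟ y) ≡.refl _) (μ-unfold s y bot≢y)) ⟩
    - ∑ size (λ x → [ below x y ]· μ s x) + ∑ size (λ x → [ below x y ]· μ s x)
      ≈⟨ -‿inverseˡ _ ⟩
    0# ∎
    where
    -- [x ≤ y] = [x = y] + [0̂ ≤ x < y], and below y the fuel can be decreased
    split : ∀ x → [ ⌊ x ≼? y ⌋ ]· μ (suc s) x ≈ [ ⌊ x F.≟ y ⌋ ]· μ (suc s) x + [ below x y ]· μ s x
    split x with x ≼? y | x F.≟ y | bot ≼? x
    ... | _      | _        | no bot⋠x   = ⊥-elim (bot⋠x (bot-min x))
    ... | yes _  | yes _    | yes _      = sym (+-identityʳ _)
    ... | yes x≼y | no x≢y  | yes _      =
      trans (sym (μ-stable s x (ℕP.<-≤-trans (rank-< (x≼y , x≢y)) (ℕP.≤-pred ρy<1+s)))) (sym (+-identityˡ _))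
    ... | no x⋠y | yes ≡.refl | yes _    = ⊥-elim (x⋠y ≼-refl)
    ... | no _   | no _     | yes _      = sym (+-identityˡ _)

  -- The actual Möbius function uses fuel |P|, which exceeds every rank.
  mobius-bot : mobius R P bot bot ≈ 1#
  mobius-bot = fuel-positive bot
    where
    -- the fuel |P| is positive since 0̂ is an element
    fuel-positive : ∀ {n} → Fin n → mobiusFuel R P n bot bot ≈ 1#
    fuel-positive {suc s} _ = μ-bot s

  mobius-sum : ∀ y → ∑ size (λ x → [ ⌊ x ≼? y ⌋ ]· mobius R P bot x) ≈ [ ⌊ y F.≟ bot ⌋ ]· 1#
  mobius-sum y with y F.≟ bot
  ... | yes ≡.refl = trans (∑-single size _ bot only-bot) (trans (when-yes (bot ≼? bot) ≼-refl _) mobius-bot)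
    where
    only-bot : ∀ x → x ≢ bot → [ ⌊ x ≼? bot ⌋ ]· mobius R P bot x ≈ 0#
    only-bot x x≢bot = when-no (x ≼? bot) (λ x≼bot → x≢bot (≼-antisym x≼bot (bot-min x))) _
  ... | no y≢bot = vanish size (rank<size y)
    where
    vanish : ∀ n → rank y < n → ∑ size (λ x → [ ⌊ x ≼? y ⌋ ]· mobiusFuel R P n bot x) ≈ 0#
    vanish (suc s) ρy<n = μ-sum-vanishes s y (λ e → y≢bot (≡.sym e)) ρy<n

module WhitneyNumbers {c r : Level} (R : CommutativeRing c r) where
  open CommutativeRing R
  open FiniteSums R
  open import Data.Nat using (_<_)
  open import Relation.Binary.Reasoning.Setoid setoid

  levelSum : (P : GradedPoset) → Weight R P → Pt P → ℕ → Carrier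
  levelSum P ϖ x e = ∑ size (λ y → [ ⌊ (x ≼? y) ×-dec (rank y ℕ.≟ e) ⌋ ]· ϖ x y)
    where open GradedPoset P

  levelAbove : (P : GradedPoset) → Weight R P → ℕ → Pt P → Carrier
  levelAbove P ϖ d x = levelSum P ϖ x (GradedPoset.rank P x ℕ.+ d)

  whitney-W≈levelSum : ∀ P ϖ d → whitney-W R P ϖ d ≈ levelSum P ϖ (GradedPoset.bot P) d
  whitney-W≈levelSum P ϖ d = ∑-cong size (λ y →
    when-⇔ (rank y ℕ.≟ d) ((bot ≼? y) ×-dec (rank y ℕ.≟ d)) (bot-min y ,_) proj₂ (ϖ bot y))
    where open GradedPoset P

  -- no element above x has rank below ρ(x)
  levelSum-below : ∀ P ϖ x e → e < GradedPoset.rank P x → levelSum P ϖ x e ≈ 0#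
  levelSum-below P ϖ x e e<ρx = ∑-zero size (λ y →
    when-no ((x ≼? y) ×-dec (rank y ℕ.≟ e))
      (λ (x≼y , ρy≡e) → ℕP.<⇒≱ e<ρx (≡.subst (rank x ℕ.≤_) ρy≡e (rank-≤ x≼y))) (ϖ x y))
    where
    open GradedPoset P
    open GradedFacts P

  levelSum-iso : ∀ {P Q a b} (φ : UpIso P a Q b) (ϖ : Weight R P) (v : Weight R Q) →
    (∀ s s' → GradedPoset._≼_ P a s → GradedPoset._≼_ P s s' → v (to φ s) (to φ s') ≈ ϖ s s') →
    ∀ z → GradedPoset._≼_ P a z → ∀ d →
    levelAbove P ϖ d z ≈ levelAbove Q v d (to φ z)
  levelSum-iso {P} {Q} {a} φ ϖ v carries z a≼z d =
    trans (∑-cong P.size (λ s → when-cong (S? s) (λ (z≼s , _) → sym (carries z s a≼z z≼s))))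
          (∑-reindex S? T? (to φ) maps
             (λ (z≼s , _) (z≼s' , _) → I.injective (GP.≼-trans a≼z z≼s) (GP.≼-trans a≼z z≼s'))
             onto (v (to φ z)))
    where
    module P = GradedPoset P
    module Q = GradedPoset Q
    module GP = GradedFacts P
    module GQ = GradedFacts Q
    module I = UpIsoFacts φ
    S? : ∀ s → Dec (z P.≼ s × P.rank s ≡ P.rank z ℕ.+ d)
    S? s = (z P.≼? s) ×-dec (P.rank s ℕ.≟ P.rank z ℕ.+ d)
    T? : ∀ y → Dec (to φ z Q.≼ y × Q.rank y ≡ Q.rank (to φ z) ℕ.+ d)
    T? y = (to φ z Q.≼? y) ×-dec (Q.rank y ℕ.≟ Q.rank (to φ z) ℕ.+ d)
    maps : ∀ {s} → z P.≼ s × P.rank s ≡ P.rank z ℕ.+ d →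
           to φ z Q.≼ to φ s × Q.rank (to φ s) ≡ Q.rank (to φ z) ℕ.+ d
    maps (z≼s , level) = I.mono a≼z z≼s , I.rank-difference d a≼z (GP.≼-trans a≼z z≼s) level
    onto : ∀ {y} → to φ z Q.≼ y × Q.rank y ≡ Q.rank (to φ z) ℕ.+ d →
           ∃ λ s → (z P.≼ s × P.rank s ≡ P.rank z ℕ.+ d) × to φ s ≡ y
    onto {y} (φz≼y , level) with UpIso.onto φ y (GQ.≼-trans (UpIso.into φ z a≼z) φz≼y)
    ... | s , a≼s , ≡.refl = s , (I.reflect a≼z a≼s φz≼y , I.rank-difference⁻¹ d a≼z a≼s level) , ≡.refl

  -- Weighted Möbius inversion on one rank level:
  -- Σ_x μ(0̂,x) v(0̂,x) L(x, e) = Σ_{ρ(y) = e} v(0̂,y) Σ_{x ≤ y} μ(0̂,x) = [e = 0].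
  weighted-mobius : ∀ Q (v : Weight R Q) → Compatible R Q v → ∀ e →
    ∑ (GradedPoset.size Q) (λ x → (mobius R Q (GradedPoset.bot Q) x * v (GradedPoset.bot Q) x) * levelSum Q v x e)
      ≈ [ ⌊ e ℕ.≟ 0 ⌋ ]· 1#
  weighted-mobius Q v (v-refl , v-trans) e = begin
    ∑ size (λ x → μv x * levelSum Q v x e)
      ≈⟨ ∑-cong size (λ x → ∑-*ˡ size (μv x) _) ⟩
    ∑ size (λ x → ∑ size (λ y → μv x * [ ⌊ (x ≼? y) ×-dec (rank y ℕ.≟ e) ⌋ ]· v x y))
      ≈⟨ ∑-swap size size _ ⟩
    ∑ size (λ y → ∑ size (λ x → μv x * [ ⌊ (x ≼? y) ×-dec (rank y ℕ.≟ e) ⌋ ]· v x y))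
      ≈⟨ ∑-cong size factor ⟩
    ∑ size (λ y → [ ⌊ rank y ℕ.≟ e ⌋ ]· (v bot y * ∑ size (λ x → [ ⌊ x ≼? y ⌋ ]· μ x)))
      ≈⟨ ∑-cong size (λ y → when-cong (rank y ℕ.≟ e) (λ _ → *-congˡ (M.mobius-sum y))) ⟩
    ∑ size (λ y → [ ⌊ rank y ℕ.≟ e ⌋ ]· (v bot y * [ ⌊ y F.≟ bot ⌋ ]· 1#))
      ≈⟨ ∑-single size _ bot off-bot ⟩
    [ ⌊ rank bot ℕ.≟ e ⌋ ]· (v bot bot * [ ⌊ bot F.≟ bot ⌋ ]· 1#)
      ≈⟨ when-cong (rank bot ℕ.≟ e) (λ _ → trans (*-cong (v-refl bot) (when-yes (bot F.≟ bot) ≡.refl 1#)) (*-identityˡ 1#)) ⟩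
    [ ⌊ rank bot ℕ.≟ e ⌋ ]· 1#
      ≈⟨ when-⇔ (rank bot ℕ.≟ e) (e ℕ.≟ 0) (λ ρ0≡e → ≡.trans (≡.sym ρ0≡e) rank-bot) (λ e≡0 → ≡.trans rank-bot (≡.sym e≡0)) 1# ⟩
    [ ⌊ e ℕ.≟ 0 ⌋ ]· 1# ∎
    where
    open GradedPoset Q
    module M = MobiusFacts R Q
    μ : Pt Q → Carrier
    μ = mobius R Q bot
    μv : Pt Q → Carrier
    μv x = μ x * v bot x

    -- multiplicativity v(0̂,y) = v(0̂,x) v(x,y) for x ≤ y
    factor : ∀ y → ∑ size (λ x → μv x * [ ⌊ (x ≼? y) ×-dec (rank y ℕ.≟ e) ⌋ ]· v x y)
                   ≈ [ ⌊ rank y ℕ.≟ e ⌋ ]· (v bot y * ∑ size (λ x → [ ⌊ x ≼? y ⌋ ]· μ x))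
    factor y = sym (begin
      [ ⌊ rank y ℕ.≟ e ⌋ ]· (v bot y * ∑ size (λ x → [ ⌊ x ≼? y ⌋ ]· μ x))
        ≈⟨ when-cong (rank y ℕ.≟ e) (λ _ → ∑-*ˡ size (v bot y) _) ⟩
      [ ⌊ rank y ℕ.≟ e ⌋ ]· ∑ size (λ x → v bot y * [ ⌊ x ≼? y ⌋ ]· μ x)
        ≈⟨ when-∑ _ size _ ⟩
      ∑ size (λ x → [ ⌊ rank y ℕ.≟ e ⌋ ]· (v bot y * [ ⌊ x ≼? y ⌋ ]· μ x))
        ≈⟨ ∑-cong size term ⟩
      ∑ size (λ x → μv x * [ ⌊ (x ≼? y) ×-dec (rank y ℕ.≟ e) ⌋ ]· v x y) ∎)
      where
      term : ∀ x → [ ⌊ rank y ℕ.≟ e ⌋ ]· (v bot y * [ ⌊ x ≼? y ⌋ ]· μ x)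
                   ≈ μv x * [ ⌊ (x ≼? y) ×-dec (rank y ℕ.≟ e) ⌋ ]· v x y
      term x with x ≼? y | rank y ℕ.≟ e
      ... | yes x≼y | yes _ = begin
        v bot y * μ x             ≈⟨ *-congʳ (v-trans bot x y (bot-min x) x≼y) ⟩
        (v bot x * v x y) * μ x   ≈⟨ *-comm _ _ ⟩
        μ x * (v bot x * v x y)   ≈⟨ *-assoc _ _ _ ⟨
        μv x * v x y ∎
      ... | yes _ | no _ = sym (zeroʳ _)
      ... | no _  | yes _ = trans (zeroʳ _) (sym (zeroʳ _))
      ... | no _  | no _ = sym (zeroʳ _)

    off-bot : ∀ y → y ≢ bot → [ ⌊ rank y ℕ.≟ e ⌋ ]· (v bot y * [ ⌊ y F.≟ bot ⌋ ]· 1#) ≈ 0#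
    off-bot y y≢bot = trans (when-cong (rank y ℕ.≟ e) (λ _ →
                        trans (*-congˡ (when-no (y F.≟ bot) y≢bot 1#)) (zeroʳ _))) (when-zero _)

  whitney-w-shifted : ∀ Q (v : Weight R Q) K I →
    [ ⌊ K ℕ.≤? I ⌋ ]· whitney-w R Q v (I ℕ.∸ K)
      ≈ ∑ (GradedPoset.size Q) (λ x → [ ⌊ GradedPoset.rank Q x ℕ.+ K ℕ.≟ I ⌋ ]·
                                         (mobius R Q (GradedPoset.bot Q) x * v (GradedPoset.bot Q) x))
  whitney-w-shifted Q v K I = trans (when-∑ ⌊ K ℕ.≤? I ⌋ size _) (∑-cong size (λ x →
    when-when-⇔ (K ℕ.≤? I) (rank x ℕ.≟ I ℕ.∸ K) (rank x ℕ.+ K ℕ.≟ I)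
      (λ K≤I ρx≡I-K → ≡.trans (≡.cong (ℕ._+ K) ρx≡I-K) (ℕP.m∸n+n≡m K≤I))
      (λ ρx+K≡I → ≡.subst (K ℕ.≤_) ρx+K≡I (ℕP.m≤n+m K (rank x)) ,
                  ≡.trans (≡.sym (ℕP.m+n∸n≡m (rank x) K)) (≡.cong (ℕ._∸ K) ρx+K≡I))
      _))
    where open GradedPoset Q

  -- w_0 = μ(0̂,0̂) v(0̂,0̂) = 1, since 0̂ is the only element of rank 0.
  whitney-w-zero : ∀ Q (v : Weight R Q) → Compatible R Q v → whitney-w R Q v 0 ≈ 1#
  whitney-w-zero Q v (v-refl , _) = begin
    whitney-w R Q v 0                                           ≈⟨ ∑-single size _ bot only-bot ⟩
    [ ⌊ rank bot ℕ.≟ 0 ⌋ ]· (mobius R Q bot bot * v bot bot)   ≈⟨ when-yes (rank bot ℕ.≟ 0) rank-bot _ ⟩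
    mobius R Q bot bot * v bot bot                              ≈⟨ *-cong (MobiusFacts.mobius-bot R Q) (v-refl bot) ⟩
    1# * 1#                                                     ≈⟨ *-identityˡ 1# ⟩
    1#                                                          ∎
    where
    open GradedPoset Q
    only-bot : ∀ x → x ≢ bot → [ ⌊ rank x ℕ.≟ 0 ⌋ ]· (mobius R Q bot x * v bot x) ≈ 0#
    only-bot x x≢bot = when-no (rank x ℕ.≟ 0) (λ ρx≡0 → x≢bot (GradedFacts.rank≡0⇒bot Q x ρx≡0)) _

module TriangularMatrices {c r : Level} (R : CommutativeRing c r) (ℓ : ℕ) where
  open CommutativeRing R
  open FiniteSums R
  open import Data.Nat using (_<_)
  open import Relation.Binary.Definitions using (tri<; tri≈; tri>)
  open import Induction.WellFounded using (Acc; acc)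
  import Data.Fin.Induction as FinInd
  open import Relation.Binary.Reasoning.Setoid setoid

  private
    n : ℕ
    n = suc ℓ
    _⊛_ : Matrix R ℓ → Matrix R ℓ → Matrix R ℓ
    _⊛_ = _⊗_ R
    _≋_ : Matrix R ℓ → Matrix R ℓ → Set r
    _≋_ = _≈M_ R
    I : Matrix R ℓ
    I = identity R

  ⊛-assoc : ∀ X Y Z → ((X ⊛ Y) ⊛ Z) ≋ (X ⊛ (Y ⊛ Z))
  ⊛-assoc X Y Z i j = begin
    ∑ n (λ m → ∑ n (λ k → X i k * Y k m) * Z m j)    ≈⟨ ∑-cong n (λ m → ∑-*ʳ n (Z m j) (λ k → X i k * Y k m)) ⟩
    ∑ n (λ m → ∑ n (λ k → (X i k * Y k m) * Z m j))  ≈⟨ ∑-swap n n (λ m k → (X i k * Y k m) * Z m j) ⟩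
    ∑ n (λ k → ∑ n (λ m → (X i k * Y k m) * Z m j))  ≈⟨ ∑-cong n (λ k → ∑-cong n (λ m → *-assoc (X i k) (Y k m) (Z m j))) ⟩
    ∑ n (λ k → ∑ n (λ m → X i k * (Y k m * Z m j)))  ≈⟨ ∑-cong n (λ k → ∑-*ˡ n (X i k) (λ m → Y k m * Z m j)) ⟨
    ∑ n (λ k → X i k * ∑ n (λ m → Y k m * Z m j))    ∎

  ⊛-congʳ : ∀ {X X'} Y → X ≋ X' → (X ⊛ Y) ≋ (X' ⊛ Y)
  ⊛-congʳ {X} {X'} Y X≋X' i j = ∑-cong n {λ k → X i k * Y k j} {λ k → X' i k * Y k j} (λ k → *-congʳ (X≋X' i k))

  ⊛-identityˡ : ∀ X → (I ⊛ X) ≋ X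
  ⊛-identityˡ X i j =
    trans (∑-single n (λ k → I i k * X k j) i (λ k k≢i → trans (*-congʳ (when-no (i F.≟ k) (λ e → k≢i (≡.sym e)) 1#)) (zeroˡ _)))
          (trans (*-congʳ (when-yes (i F.≟ i) ≡.refl 1#)) (*-identityˡ _))

  ⊛-identityʳ : ∀ X → (X ⊛ I) ≋ X
  ⊛-identityʳ X i j =
    trans (∑-single n (λ k → X i k * I k j) j (λ k k≢j → trans (*-congˡ (when-no (k F.≟ j) k≢j 1#)) (zeroʳ _)))
          (trans (*-congˡ (when-yes (j F.≟ j) ≡.refl 1#)) (*-identityʳ _))

  LowerUnitriangular : Matrix R ℓ → Set r
  LowerUnitriangular A = (∀ i k → toℕ i < toℕ k → A i k ≈ 0#) × (∀ i → A i i ≈ 1#)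

  -- Row i of A ⊛ X is X_i plus a combination of the earlier rows; induct on i.
  unitriangular-cancel : ∀ A → LowerUnitriangular A → ∀ X Y → (A ⊛ X) ≋ (A ⊛ Y) → X ≋ Y
  unitriangular-cancel A (upper-zero , diagonal-one) X Y AX≋AY i = rows i (FinInd.<-wellFounded i)
    where
    rows : ∀ i → Acc F._<_ i → ∀ j → X i j ≈ Y i j
    rows i (acc earlier) j = begin
      X i j          ≈⟨ *-identityˡ _ ⟨
      1# * X i j     ≈⟨ *-congʳ (diagonal-one i) ⟨
      A i i * X i j  ≈⟨ ∑-agree-at n (λ k → A i k * X k j) (λ k → A i k * Y k j) i off-diagonal (AX≋AY i j) ⟩
      A i i * Y i j  ≈⟨ *-congʳ (diagonal-one i) ⟩
      1# * Y i j     ≈⟨ *-identityˡ _ ⟩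
      Y i j          ∎
      where
      off-diagonal : ∀ k → k ≢ i → A i k * X k j ≈ A i k * Y k j
      off-diagonal k k≢i with ℕP.<-cmp (toℕ k) (toℕ i)
      ... | tri< k<i _ _ = *-congˡ (rows k (earlier k<i) j)
      ... | tri≈ _ k≡i _ = ⊥-elim (k≢i (FP.toℕ-injective k≡i))
      ... | tri> _ _ i<k = trans (*-congʳ (upper-zero i k i<k))
                                 (trans (zeroˡ _) (sym (trans (*-congʳ (upper-zero i k i<k)) (zeroˡ _))))

  -- A(BA) = (AB)A = A = AI, and A cancels.
  right-inverse⇒left-inverse : ∀ A B → LowerUnitriangular A → (A ⊛ B) ≋ I → (B ⊛ A) ≋ I
  right-inverse⇒left-inverse A B A-unitriangular AB≋I =
    unitriangular-cancel A A-unitriangular (B ⊛ A) I A[BA]≋AI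
    where
    A[BA]≋AI : (A ⊛ (B ⊛ A)) ≋ (A ⊛ I)
    A[BA]≋AI i j = begin
      (A ⊛ (B ⊛ A)) i j  ≈⟨ ⊛-assoc A B A i j ⟨
      ((A ⊛ B) ⊛ A) i j  ≈⟨ ⊛-congʳ A AB≋I i j ⟩
      (I ⊛ A) i j        ≈⟨ ⊛-identityˡ A i j ⟩
      A i j              ≈⟨ ⊛-identityʳ A i j ⟨
      (A ⊛ I) i j        ∎

module IndexArithmetic where
  open import Data.Nat using (_+_; _∸_; _≤_; _<_)
  open import Algebra.Properties.CommutativeSemigroup ℕP.+-commutativeSemigroup
    using () renaming (xy∙z≈xz∙y to +-right-comm)
  open ≡.≡-Reasoning

  -- rank a + k = i inside an ideal based at rank b with b + i = ℓ means rank ℓ - k in the whole poset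
  stacked-ranks : ∀ a b k i ℓ → a + k ≡ i → b + i ≡ ℓ → (a + b) + k ≡ ℓ
  stacked-ranks a b k i ℓ a+k≡i b+i≡ℓ = begin
    (a + b) + k  ≡⟨ +-right-comm a b k ⟩
    (a + k) + b  ≡⟨ ≡.cong (_+ b) a+k≡i ⟩
    i + b        ≡⟨ ℕP.+-comm i b ⟩
    b + i        ≡⟨ b+i≡ℓ ⟩
    ℓ            ∎

  ∸-after-∸ : ∀ {r I J} → r ≤ I → J ≤ I ∸ r → r + ((I ∸ r) ∸ J) ≡ I ∸ J
  ∸-after-∸ {r} {I} {J} r≤I J≤I-r = begin
    r + ((I ∸ r) ∸ J)  ≡⟨ ℕP.+-∸-assoc r J≤I-r ⟨
    (r + (I ∸ r)) ∸ J  ≡⟨ ≡.cong (_∸ J) (ℕP.m+[n∸m]≡n r≤I) ⟩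
    I ∸ J              ∎

  ∸-beyond : ∀ {r I J} → J ≤ I → ¬ (J ≤ I ∸ r) → I ∸ J < r
  ∸-beyond {r} {I} {J} J≤I J≰I-r = ℕP.≰⇒> (λ r≤I-J → J≰I-r (ℕP.m+n≤o⇒m≤o∸n J
    (≡.subst (_≤ I) (ℕP.+-comm r J) (ℕP.m≤o∸n⇒m+n≤o r J≤I r≤I-J))))

module WhitneyMatrices {c r : Level} (R : CommutativeRing c r) (ℓ : ℕ)
  (Ps : Fin (suc ℓ) → GradedPoset) (ϖs : (i : Fin (suc ℓ)) → Weight R (Ps i))
  (compatibles : ∀ i → Compatible R (Ps i) (ϖs i)) where
  open CommutativeRing R
  open FiniteSums R
  open WhitneyNumbers R
  open TriangularMatrices R ℓ using (LowerUnitriangular)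
  open IndexArithmetic
  import Relation.Binary.Reasoning.Setoid setoid as ≈-Reasoning

  w : Matrix R ℓ
  w = wMatrix R ℓ Ps ϖs

  W : Matrix R ℓ
  W = WMatrix R ℓ Ps ϖs

  w-unitriangular : LowerUnitriangular w
  w-unitriangular = upper-zero , diagonal-one
    where
    upper-zero : ∀ i k → toℕ i ℕ.< toℕ k → w i k ≈ 0#
    upper-zero i k i<k = when-no (toℕ k ℕ.≤? toℕ i) (ℕP.<⇒≱ i<k) _
    diagonal-one : ∀ i → w i i ≈ 1#
    diagonal-one i = begin
      w i i                                           ≈⟨ when-yes (toℕ i ℕ.≤? toℕ i) ℕP.≤-refl _ ⟩
      whitney-w R (Ps i) (ϖs i) (toℕ i ℕ.∸ toℕ i)     ≡⟨ ≡.cong (whitney-w R (Ps i) (ϖs i)) (ℕP.n∸n≡0 (toℕ i)) ⟩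
      whitney-w R (Ps i) (ϖs i) 0                     ≈⟨ whitney-w-zero (Ps i) (ϖs i) (compatibles i) ⟩
      1#                                              ∎
      where open ≈-Reasoning

  -- For P uniform with uniform weight, W_d(P_k) is a level sum of any P_i at any
  -- x with ρ(x) + k = i: both are level sums of P at elements of rank ℓ - k.
  module _ (P : GradedPoset) (ϖ : Weight R P) (uniform : UniformWeight R P ϖ)
           (induced : ∀ i → InducedWeight R P ϖ ℓ i (Ps i) (ϖs i)) where
    private
      module P = GradedPoset P
      module GP = GradedFacts P

    whitney-W-transfer : ∀ i k (x : Pt (Ps i)) → GradedPoset.rank (Ps i) x ℕ.+ toℕ k ≡ toℕ i → ∀ d →
      whitney-W R (Ps k) (ϖs k) d ≈ levelAbove (Ps i) (ϖs i) d x
    whitney-W-transfer i k x ρx+k≡i d with induced k | induced i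
    ... | xₖ , ρxₖ+k≡ℓ , φₖ , φₖ-carries | xᵢ , ρxᵢ+i≡ℓ , φᵢ , φᵢ-carries
      with UpIso.onto φᵢ x (GradedPoset.bot-min (Ps i) x)
    ...   | z , xᵢ≼z , φᵢz≡x = begin
      whitney-W R (Ps k) (ϖs k) d          ≈⟨ whitney-W≈levelSum (Ps k) (ϖs k) d ⟩
      levelSum (Ps k) (ϖs k) Qₖ.bot d      ≡⟨ bot-level ⟨
      levelAbove (Ps k) (ϖs k) d (to φₖ xₖ) ≈⟨ levelSum-iso φₖ ϖ (ϖs k) φₖ-carries xₖ GP.≼-refl d ⟨
      levelAbove P ϖ d xₖ                  ≡⟨ ≡.cong (levelAbove P ϖ d) (UpIsoFacts.to-base f) ⟨
      levelAbove P ϖ d (to f z)            ≈⟨ levelSum-iso f ϖ ϖ f-carries z GP.≼-refl d ⟨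
      levelAbove P ϖ d z                   ≈⟨ levelSum-iso φᵢ ϖ (ϖs i) φᵢ-carries z xᵢ≼z d ⟩
      levelAbove (Ps i) (ϖs i) d (to φᵢ z) ≡⟨ ≡.cong (levelAbove (Ps i) (ϖs i) d) φᵢz≡x ⟩
      levelAbove (Ps i) (ϖs i) d x         ∎
      where
      module Qₖ = GradedPoset (Ps k)
      module Qᵢ = GradedPoset (Ps i)
      open ≈-Reasoning

      bot-level : levelAbove (Ps k) (ϖs k) d (to φₖ xₖ) ≡ levelSum (Ps k) (ϖs k) Qₖ.bot d
      bot-level rewrite UpIsoFacts.to-base φₖ | Qₖ.rank-bot = ≡.refl

      -- z lies at rank ℓ - k, like xₖ
      ρx+ρxᵢ≡ρz : Qᵢ.rank x ℕ.+ P.rank xᵢ ≡ P.rank z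
      ρx+ρxᵢ≡ρz = ≡.trans (≡.cong (λ q → Qᵢ.rank q ℕ.+ P.rank xᵢ) (≡.sym φᵢz≡x))
                 (≡.trans (UpIsoFacts.rank-shift φᵢ z xᵢ≼z)
                 (≡.trans (≡.cong (P.rank z ℕ.+_) Qᵢ.rank-bot) (ℕP.+-identityʳ (P.rank z))))
      ρz≡ρxₖ : P.rank z ≡ P.rank xₖ
      ρz≡ρxₖ = ℕP.+-cancelʳ-≡ (toℕ k) _ _
        (≡.trans (≡.cong (ℕ._+ toℕ k) (≡.sym ρx+ρxᵢ≡ρz))
        (≡.trans (stacked-ranks (Qᵢ.rank x) (P.rank xᵢ) (toℕ k) (toℕ i) ℓ ρx+k≡i ρxᵢ+i≡ℓ)
                 (≡.sym ρxₖ+k≡ℓ)))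

      f : UpIso P z P xₖ
      f = proj₁ (uniform z xₖ ρz≡ρxₖ)
      f-carries : ∀ s s' → z P.≼ s → s P.≼ s' → ϖ (to f s) (to f s') ≈ ϖ s s'
      f-carries s s' z≼s s≼s' = sym (proj₂ (uniform z xₖ ρz≡ρxₖ) s s' z≼s s≼s')

    -- (w W)_{ij} = Σ_k w_{i-k}(P_i) W_{k-j}(P_k)
    --           = Σ_{x ∈ P_i} μ(0̂,x) ϖ(0̂,x) L(x, i - j)   (regrouping by x, with k = i - ρ(x))
    --           = [i - j = 0]                           (weighted Möbius inversion).
    w⊗W≈identity : _≈M_ R (_⊗_ R w W) (identity R)
    w⊗W≈identity i j with toℕ j ℕ.≤? toℕ i
    ... | no j≰i = trans (∑-zero (suc ℓ) vanishing) (sym (when-no (i F.≟ j) (λ i≡j → j≰i (ℕP.≤-reflexive (≡.cong toℕ (≡.sym i≡j)))) 1#))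
      where
      vanishing : ∀ k → w i k * W k j ≈ 0#
      vanishing k with toℕ k ℕ.≤? toℕ i | toℕ j ℕ.≤? toℕ k
      ... | yes k≤i | yes j≤k = ⊥-elim (j≰i (ℕP.≤-trans j≤k k≤i))
      ... | yes _   | no _    = zeroʳ _
      ... | no _    | _       = zeroˡ _
    ... | yes j≤i = begin
      ∑ (suc ℓ) (λ k → w i k * W k j)
        ≈⟨ ∑-cong (suc ℓ) expand ⟩
      ∑ (suc ℓ) (λ k → ∑ Q.size (λ x → [ ⌊ Q.rank x ℕ.+ toℕ k ℕ.≟ I ⌋ ]· (μv x * G x (toℕ k))))
        ≈⟨ ∑-swap (suc ℓ) Q.size (λ k x → [ ⌊ Q.rank x ℕ.+ toℕ k ℕ.≟ I ⌋ ]· (μv x * G x (toℕ k))) ⟩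
      ∑ Q.size (λ x → ∑ (suc ℓ) (λ k → [ ⌊ Q.rank x ℕ.+ toℕ k ℕ.≟ I ⌋ ]· (μv x * G x (toℕ k))))
        ≈⟨ ∑-cong Q.size (λ x → ∑-at-difference i (Q.rank x) (λ K → μv x * G x K)) ⟩
      ∑ Q.size (λ x → [ ⌊ Q.rank x ℕ.≤? I ⌋ ]· (μv x * G x (I ℕ.∸ Q.rank x)))
        ≈⟨ ∑-cong Q.size collapse ⟩
      ∑ Q.size (λ x → μv x * levelSum Q v x (I ℕ.∸ J))
        ≈⟨ weighted-mobius Q v (compatibles i) (I ℕ.∸ J) ⟩
      [ ⌊ I ℕ.∸ J ℕ.≟ 0 ⌋ ]· 1#
        ≈⟨ when-⇔ (I ℕ.∸ J ℕ.≟ 0) (i F.≟ j)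
             (λ I-J≡0 → FP.toℕ-injective (ℕP.≤-antisym (ℕP.m∸n≡0⇒m≤n I-J≡0) j≤i))
             (λ i≡j → ≡.trans (≡.cong (λ t → I ℕ.∸ toℕ t) (≡.sym i≡j)) (ℕP.n∸n≡0 I)) 1# ⟩
      identity R i j ∎
      where
      open ≈-Reasoning
      Q : GradedPoset
      Q = Ps i
      module Q = GradedPoset Q
      v : Weight R Q
      v = ϖs i
      I J : ℕ
      I = toℕ i
      J = toℕ j
      μv : Pt Q → Carrier
      μv x = mobius R Q Q.bot x * v Q.bot x
      -- W_{k-j}(P_k), read as a level sum of P_i above x
      G : Pt Q → ℕ → Carrier
      G x K = [ ⌊ J ℕ.≤? K ⌋ ]· levelAbove Q v (K ℕ.∸ J) x

      expand : ∀ k → w i k * W k j ≈ ∑ Q.size (λ x → [ ⌊ Q.rank x ℕ.+ toℕ k ℕ.≟ I ⌋ ]· (μv x * G x (toℕ k)))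
      expand k = begin
        w i k * W k j
          ≈⟨ *-congʳ (whitney-w-shifted Q v (toℕ k) I) ⟩
        ∑ Q.size (λ x → [ ⌊ Q.rank x ℕ.+ toℕ k ℕ.≟ I ⌋ ]· μv x) * W k j
          ≈⟨ ∑-*ʳ Q.size (W k j) _ ⟩
        ∑ Q.size (λ x → [ ⌊ Q.rank x ℕ.+ toℕ k ℕ.≟ I ⌋ ]· μv x * W k j)
          ≈⟨ ∑-cong Q.size (λ x → trans (when-*ʳ _ (μv x) (W k j))
               (when-cong (Q.rank x ℕ.+ toℕ k ℕ.≟ I) (λ ρx+k≡i → *-congˡ (when-cong (J ℕ.≤? toℕ k) (λ _ →
                 whitney-W-transfer i k x ρx+k≡i (toℕ k ℕ.∸ J)))))) ⟩
        ∑ Q.size (λ x → [ ⌊ Q.rank x ℕ.+ toℕ k ℕ.≟ I ⌋ ]· (μv x * G x (toℕ k))) ∎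

      -- k = i - ρ(x) contributes L(x, i - j) exactly when ρ(x) + j ≤ i; otherwise L(x, i - j) = 0 anyway.
      collapse : ∀ x → [ ⌊ Q.rank x ℕ.≤? I ⌋ ]· (μv x * G x (I ℕ.∸ Q.rank x)) ≈ μv x * levelSum Q v x (I ℕ.∸ J)
      collapse x with Q.rank x ℕ.≤? I | J ℕ.≤? I ℕ.∸ Q.rank x
      ... | yes ρx≤I | yes J≤I-ρx =
        *-congˡ (reflexive (≡.cong (levelSum Q v x) (∸-after-∸ ρx≤I J≤I-ρx)))
      ... | yes ρx≤I | no J≰I-ρx = trans (zeroʳ (μv x))
        (sym (trans (*-congˡ (levelSum-below Q v x (I ℕ.∸ J) (∸-beyond j≤i J≰I-ρx))) (zeroʳ _)))
      ... | no ρx≰I | _ = sym (trans (*-congˡ (levelSum-below Q v x (I ℕ.∸ J)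
              (ℕP.≤-<-trans (ℕP.m∸n≤m I J) (ℕP.≰⇒> ρx≰I)))) (zeroʳ _))

proposition6p3 : {c r : Level} (R : CommutativeRing c r)
    (P : GradedPoset) (ℓ : ℕ) → FinPoset.PureOfLength (GradedPoset.poset P) ℓ →
    (Ps : Fin (suc ℓ) → GradedPoset) → IsUniformSeq P ℓ Ps →
    (ϖ : Weight R P) → Compatible R P ϖ → UniformWeight R P ϖ →
    (ϖs : (i : Fin (suc ℓ)) → Weight R (Ps i)) →
    (∀ i → Compatible R (Ps i) (ϖs i)) →
    (∀ i → InducedWeight R P ϖ ℓ i (Ps i) (ϖs i)) →
    InverseMatrices R (wMatrix R ℓ Ps ϖs) (WMatrix R ℓ Ps ϖs)
proposition6p3 R P ℓ _ Ps _ ϖ _ uniform ϖs compatibles induced =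
  w⊗W≈I , right-inverse⇒left-inverse w W w-unitriangular w⊗W≈I
  where
  open WhitneyMatrices R ℓ Ps ϖs compatibles
  open TriangularMatrices R ℓ using (right-inverse⇒left-inverse)
  w⊗W≈I : _≈M_ R (_⊗_ R w W) (identity R)
  w⊗W≈I = w⊗W≈identity P ϖ uniform induced
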